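{- Let $\mathcal{U}\subseteq\mathcal{E}$ be any dead-ending universe. Then $\mathcal{D}(\mathcal{U}\cap\mathcal{L})=\mathcal{U}$.
   Context: Games are finite partizan games $\{\mathscr{G}^L\mid\mathscr{G}^R\}$; disjunctive sum $G+H=\{G^L+H,G+H^L\mid G^R+H,G+H^R\}$; conjugate $\overline{G}=\{\overline{G^R}\mid\overline{G^L}\}$. A universe is a set of games closed under taking options, under sums, under conjugation, and under forming $\{\mathscr{S}\mid\mathscr{T}\}$ for nonempty finite subsets $\mathscr{S},\mathscr{T}$ of it. $\mathcal{D}(\mathcal{A})$ is the smallest universe containing $\mathcal{A}$. A Left (resp. Right) end is a game with no Left (resp. Right) option; a Left (resp. Right) dead-end is a game all of whose subpositions are Left (resp. Right) ends. $\mathcal{L}$ is the set of Left dead-ends. $\mathcal{E}$ is the set of dead-ending games: those in which every subposition that is a Left end is a Left dead-end and every subposition that is a Right end is a Right dead-end. -}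

module Defs where

open import Data.List using (List; []; _∷_; _++_)
open import Data.List.Relation.Unary.All using (All)
open import Data.List.Relation.Unary.Any using (Any)
open import Data.List.Membership.Propositional using (_∈_)
open import Data.Product using (_×_)
open import Relation.Binary.PropositionalEquality using (_≡_; _≢_)
open import Level using (suc; zero)

-- Finite partizan games in literal form {GL | GR}; option sets are
-- represented by finite lists (identified up to game identity _≅_ below).
data Game : Set where
  ⟨_∣_⟩ : List Game → List Game → Game

lefts : Game → List Game
lefts ⟨ L ∣ R ⟩ = L

rights : Game → List Game
rights ⟨ L ∣ R ⟩ = R

-- Identity of literal forms: the option SETS coincide (recursively),
-- so order and repetition in the lists are irrelevant.
data _≅_ : Game → Game → Set where
  ident : ∀ {GL GR HL HR} →
          All (λ x → Any (x ≅_) HL) GL →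
          All (λ y → Any (_≅ y) GL) HL →
          All (λ x → Any (x ≅_) HR) GR →
          All (λ y → Any (_≅ y) GR) HR →
          ⟨ GL ∣ GR ⟩ ≅ ⟨ HL ∣ HR ⟩

mutual
  _+_ : Game → Game → Game
  ⟨ GL ∣ GR ⟩ + ⟨ HL ∣ HR ⟩ =
    ⟨ addL GL ⟨ HL ∣ HR ⟩ ++ addR ⟨ GL ∣ GR ⟩ HL
    ∣ addL GR ⟨ HL ∣ HR ⟩ ++ addR ⟨ GL ∣ GR ⟩ HR ⟩

  addL : List Game → Game → List Game
  addL [] H = []
  addL (g ∷ gs) H = (g + H) ∷ addL gs H

  addR : Game → List Game → List Game
  addR G [] = []
  addR G (h ∷ hs) = (G + h) ∷ addR G hs

mutual
  conj : Game → Game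
  conj ⟨ L ∣ R ⟩ = ⟨ conjs R ∣ conjs L ⟩

  conjs : List Game → List Game
  conjs [] = []
  conjs (g ∷ gs) = conj g ∷ conjs gs

data Subpos : Game → Game → Set where
  here  : ∀ {G} → Subpos G G
  viaL  : ∀ {H G G'} → G' ∈ lefts G → Subpos H G' → Subpos H G
  viaR  : ∀ {H G G'} → G' ∈ rights G → Subpos H G' → Subpos H G

IsLeftEnd : Game → Set
IsLeftEnd G = lefts G ≡ []

IsRightEnd : Game → Set
IsRightEnd G = rights G ≡ []

LeftDeadEnd : Game → Set
LeftDeadEnd G = ∀ H → Subpos H G → IsLeftEnd H

RightDeadEnd : Game → Set
RightDeadEnd G = ∀ H → Subpos H G → IsRightEnd H

𝓛 : Game → Set
𝓛 = LeftDeadEnd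

𝓔 : Game → Set
𝓔 G = ∀ H → Subpos H G →
        (IsLeftEnd H → LeftDeadEnd H) × (IsRightEnd H → RightDeadEnd H)

_⊆_ : (Game → Set) → (Game → Set) → Set
A ⊆ B = ∀ G → A G → B G

_∩_ : (Game → Set) → (Game → Set) → Game → Set
(A ∩ B) G = A G × B G

-- A universe: a set of games (closed under identity of literal forms, as
-- it is a set of games) closed under options, sums, conjugates and
-- {S | T} for nonempty finite subsets S, T.
record IsUniverse (U : Game → Set) : Set where
  field
    respects : ∀ {G H} → G ≅ H → U G → U H
    optL     : ∀ {G G'} → U G → G' ∈ lefts G → U G'
    optR     : ∀ {G G'} → U G → G' ∈ rights G → U G'
    sum      : ∀ {G H} → U G → U H → U (G + H)
    conjc    : ∀ {G} → U G → U (conj G)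
    form     : ∀ {S T} → S ≢ [] → T ≢ [] → All U S → All U T → U ⟨ S ∣ T ⟩

𝓓 : (Game → Set) → Game → Set₁
𝓓 A G = ∀ (V : Game → Set) → IsUniverse V → A ⊆ V → V G

-- A Left end of a dead-ending game is a Left dead-end, and a Right end is the
-- conjugate of a Left dead-end.  So by induction on G ∈ U, every game of U is
-- obtained from games of U ∩ 𝓛 by conjugation (for Right ends) or by forming
-- {S ∣ T} with nonempty S, T (otherwise); any universe containing U ∩ 𝓛
-- therefore contains U.
module Submission where

open import Defs
open import Data.Product using (_×_; _,_; Σ-syntax; proj₁; proj₂)
open import Data.List using ([]; _∷_)
open import Data.List.Relation.Unary.All using (All; []; _∷_; tabulate)
open import Data.List.Relation.Unary.Any using (here; there)
open import Data.List.Membership.Propositional using (_∈_)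
open import Relation.Binary.PropositionalEquality using (_≡_; refl; subst; cong₂)

mutual
  conj-involutive : ∀ G → conj (conj G) ≡ G
  conj-involutive ⟨ L ∣ R ⟩ = cong₂ ⟨_∣_⟩ (conjs-involutive L) (conjs-involutive R)

  conjs-involutive : ∀ Gs → conjs (conjs Gs) ≡ Gs
  conjs-involutive []       = refl
  conjs-involutive (G ∷ Gs) = cong₂ _∷_ (conj-involutive G) (conjs-involutive Gs)

∈-conjs⁻ : ∀ {H} Gs → H ∈ conjs Gs → Σ[ G ∈ Game ] G ∈ Gs × H ≡ conj G
∈-conjs⁻ (G ∷ Gs) (here H≡Ḡ) = G , here refl , H≡Ḡ
∈-conjs⁻ (G ∷ Gs) (there H∈) with ∈-conjs⁻ Gs H∈
... | G' , G'∈ , H≡Ḡ' = G' , there G'∈ , H≡Ḡ'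

Subpos-conj⁻ : ∀ {H} G → Subpos H (conj G) → Σ[ H' ∈ Game ] Subpos H' G × H ≡ conj H'
Subpos-conj⁻ G here = G , here , refl
Subpos-conj⁻ ⟨ L ∣ R ⟩ (viaL G'∈ s) with ∈-conjs⁻ R G'∈
... | G' , G'∈R , refl with Subpos-conj⁻ G' s
...   | H' , s' , H≡H̄' = H' , viaR G'∈R s' , H≡H̄'
Subpos-conj⁻ ⟨ L ∣ R ⟩ (viaR G'∈ s) with ∈-conjs⁻ L G'∈
... | G' , G'∈L , refl with Subpos-conj⁻ G' s
...   | H' , s' , H≡H̄' = H' , viaL G'∈L s' , H≡H̄'

RightDeadEnd⇒LeftDeadEnd-conj : ∀ G → RightDeadEnd G → LeftDeadEnd (conj G)
RightDeadEnd⇒LeftDeadEnd-conj G rde H s with Subpos-conj⁻ G s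
... | ⟨ _ ∣ _ ⟩ , s' , refl with rde _ s'
...   | refl = refl

𝓔-leftEnd⇒𝓛 : ∀ {G} → 𝓔 G → IsLeftEnd G → 𝓛 G
𝓔-leftEnd⇒𝓛 e = proj₁ (e _ here)

𝓔-rightEnd⇒𝓛-conj : ∀ {G} → 𝓔 G → IsRightEnd G → 𝓛 (conj G)
𝓔-rightEnd⇒𝓛-conj e end = RightDeadEnd⇒LeftDeadEnd-conj _ (proj₂ (e _ here) end)

𝓓-least : ∀ {A V} → IsUniverse V → A ⊆ V → ∀ G → 𝓓 A G → V G
𝓓-least {V = V} uV A⊆V G G∈𝓓A = G∈𝓓A V uV A⊆V

module _ {U V : Game → Set} (uU : IsUniverse U) (U⊆𝓔 : U ⊆ 𝓔)
         (uV : IsUniverse V) (U∩𝓛⊆V : (U ∩ 𝓛) ⊆ V) where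
  open IsUniverse

  mutual
    dead-ending-universe⊆ : U ⊆ V
    dead-ending-universe⊆ ⟨ [] ∣ R ⟩ u = U∩𝓛⊆V _ (u , 𝓔-leftEnd⇒𝓛 (U⊆𝓔 _ u) refl)
    dead-ending-universe⊆ ⟨ G ∷ L ∣ [] ⟩ u =
      subst V (conj-involutive _)
        (conjc uV (U∩𝓛⊆V _ (conjc uU u , 𝓔-rightEnd⇒𝓛-conj (U⊆𝓔 _ u) refl)))
    dead-ending-universe⊆ ⟨ G ∷ L ∣ H ∷ R ⟩ u =
      form uV (λ ()) (λ ())
        (All-dead-ending-universe⊆ (G ∷ L) (tabulate (optL uU u)))
        (All-dead-ending-universe⊆ (H ∷ R) (tabulate (optR uU u)))

    All-dead-ending-universe⊆ : ∀ Gs → All U Gs → All V Gs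
    All-dead-ending-universe⊆ []       []       = []
    All-dead-ending-universe⊆ (G ∷ Gs) (u ∷ us) =
      dead-ending-universe⊆ G u ∷ All-dead-ending-universe⊆ Gs us

proposition2p5 : (U : Game → Set) → IsUniverse U → U ⊆ 𝓔 →
                 ∀ G → (𝓓 (U ∩ 𝓛) G → U G) × (U G → 𝓓 (U ∩ 𝓛) G)
proposition2p5 U uU U⊆𝓔 G =
  𝓓-least uU (λ _ → proj₁) G ,
  λ u V uV U∩𝓛⊆V → dead-ending-universe⊆ uU U⊆𝓔 uV U∩𝓛⊆V G u
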